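{- For every integer $t \geq 1$ there exists a solution to $\mathrm{HWP}(12t;6,4;1,6t-2)$.
   Context: For integers $M,N \geq 3$ and even $v$, a solution to $\mathrm{HWP}(v;M,N;\alpha,\beta)$ is a decomposition of the edge set of $K_v - F$, for some 1-factor (perfect matching) $F$ of $K_v$, into $\alpha$ $C_M$-factors and $\beta$ $C_N$-factors, where a $C_M$-factor is a spanning subgraph all of whose connected components are cycles of length $M$. -}

module Defs where

open import Data.Nat using (ℕ; suc; _≡ᵇ_)
open import Data.Fin using (Fin; zero; suc; toℕ; _↑ˡ_; _↑ʳ_)
open import Data.Product using (Σ; ∃; _×_; _,_)
open import Data.Sum using (_⊎_)
open import Relation.Binary.PropositionalEquality using (_≡_; _≢_)

-- A (simple) graph on vertex set Fin v, given by its adjacency relation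
-- (only pairs x ≢ y are meaningful).
Graph : ℕ → Set₁
Graph v = Fin v → Fin v → Set

CycAdj : (M : ℕ) → Fin M → Fin M → Set
CycAdj M j j' = (suc (toℕ j) ≡ toℕ j') ⊎ ((suc (toℕ j) ≡ M) × (toℕ j' ≡ 0))

-- G is a C_M-factor of K_v: there are k cycles of length M
-- (cyc i : Fin M → Fin v is the i-th cycle, listed in cyclic order),
-- whose vertex sets partition Fin v (the map (i , j) ↦ cyc i j is a
-- bijection Fin k × Fin M → Fin v), and the edges of G are exactly the
-- edges of these cycles.
IsCycleFactor : (v M : ℕ) → Graph v → Set
IsCycleFactor v M G =
  Σ ℕ λ k → Σ (Fin k → Fin M → Fin v) λ cyc →
      (∀ i j i' j' → cyc i j ≡ cyc i' j' → (i ≡ i') × (j ≡ j'))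
    × (∀ x → ∃ λ i → ∃ λ j → cyc i j ≡ x)
    × (∀ x y → G x y →
         ∃ λ i → ∃ λ j → ∃ λ j' → CycAdj M j j' ×
           (((x ≡ cyc i j) × (y ≡ cyc i j')) ⊎ ((y ≡ cyc i j) × (x ≡ cyc i j'))))
    × (∀ i j j' → CycAdj M j j' → G (cyc i j) (cyc i j') × G (cyc i j') (cyc i j))

IsOneFactor : (v : ℕ) → Graph v → Set
IsOneFactor v G =
    (∀ x → ∃ λ y → G x y)
  × (∀ x y z → G x y → G x z → y ≡ z)

-- A solution to HWP(v; M, N; α, β): an edge-labelling of K_v by
-- 1 + α + β labels (each edge {x,y}, x ≢ y, gets exactly one label, the
-- labelling being symmetric), such that label 0 is a 1-factor F, labels
-- 1..α are C_M-factors and labels α+1..α+β are C_N-factors.  This is exactly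
-- a decomposition of K_v - F into α C_M-factors and β C_N-factors.
ColourClass : ∀ {v n} → (Fin v → Fin v → Fin n) → Fin n → Graph v
ColourClass col c x y = (x ≢ y) × (col x y ≡ c)

HWP : (v M N α β : ℕ) → Set
HWP v M N α β =
  Σ (Fin v → Fin v → Fin (suc (α Data.Nat.+ β))) λ col →
      (∀ x y → x ≢ y → col x y ≡ col y x)
    × IsOneFactor v (ColourClass col zero)
    × (∀ (i : Fin α) → IsCycleFactor v M (ColourClass col (suc (i ↑ˡ β))))
    × (∀ (j : Fin β) → IsCycleFactor v N (ColourClass col (suc (α ↑ʳ j))))

-- Take the round-robin 1-factorisation F₀, …, F_{2t-2} of K_{2t} on ℤ_{2t-1} ∪ {∞} and replace every
-- point by 6 vertices.  Each edge of F₀, together with the edges inside its two points, becomes a K₁₂,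
-- decomposed by a solution of HWP(12; 6, 4; 1, 4); each edge of another Fₕ becomes a K₆,₆, split into
-- three C₄-factors.  This yields one 1-factor, one C₆-factor and 4 + 3 (2t - 2) = 6t - 2 C₄-factors.
module Submission where

open import Defs
open import Data.Nat using (ℕ; _+_; _*_; _∸_; _≤_; _%_; NonZero)
import Data.Nat as ℕ
open import Data.Nat.Tactic.RingSolver using (solve-∀)
open import Data.Fin using (Fin; zero; suc; toℕ; #_; remQuot; combine; splitAt; join; _↑ˡ_; _↑ʳ_)
open import Data.Fin.Properties
  using ( _≟_; all?; any?; *↔×; remQuot-combine; combine-remQuot
        ; splitAt-↑ˡ; splitAt-↑ʳ; splitAt⁻¹-↑ˡ; splitAt⁻¹-↑ʳ )
open import Data.Vec using (Vec; []; _∷_; lookup)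
open import Data.Product using (∃; _×_; _,_; proj₁; proj₂)
open import Data.Product.Function.NonDependent.Propositional using (_×-↔_)
open import Data.Sum using (_⊎_; inj₁; inj₂; map₂)
open import Data.Empty using (⊥-elim)
open import Function using (_∘_)
open import Function.Bundles using (_⇔_; _↔_; Equivalence; Inverse; Injection; mk⇔; mk↔ₛ′)
open import Function.Properties.Inverse using (↔-refl; ↔-sym; ↔-trans; Inverse⇒Injection)
open import Relation.Nullary using (Dec; yes; no; ¬?; _×-dec_; _⊎-dec_; _→-dec_)
open import Relation.Nullary.Decidable using (True; toWitness)
open import Relation.Binary using (Decidable; DecidableEquality)
open import Relation.Binary.PropositionalEquality

-- Deciding factors of small graphs

cycAdj? : ∀ M (j j' : Fin M) → Dec (CycAdj M j j')
cycAdj? M j j' =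
  (ℕ.suc (toℕ j) ℕ.≟ toℕ j') ⊎-dec ((ℕ.suc (toℕ j) ℕ.≟ M) ×-dec (toℕ j' ℕ.≟ 0))

IsCycleFactorWith : ∀ {v M k} → Graph v → (Fin k → Fin M → Fin v) → Set
IsCycleFactorWith {M = M} G cyc =
    (∀ i j i' j' → cyc i j ≡ cyc i' j' → (i ≡ i') × (j ≡ j'))
  × (∀ x → ∃ λ i → ∃ λ j → cyc i j ≡ x)
  × (∀ x y → G x y →
       ∃ λ i → ∃ λ j → ∃ λ j' → CycAdj M j j' ×
         (((x ≡ cyc i j) × (y ≡ cyc i j')) ⊎ ((y ≡ cyc i j) × (x ≡ cyc i j'))))
  × (∀ i j j' → CycAdj M j j' → G (cyc i j) (cyc i j') × G (cyc i j') (cyc i j))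

isCycleFactorWith? : ∀ {v M k} {G : Graph v} → Decidable G →
                     (cyc : Fin k → Fin M → Fin v) → Dec (IsCycleFactorWith G cyc)
isCycleFactorWith? {M = M} G? cyc =
        all? (λ i → all? λ j → all? λ i' → all? λ j' →
          (cyc i j ≟ cyc i' j') →-dec ((i ≟ i') ×-dec (j ≟ j')))
  ×-dec all? (λ x → any? λ i → any? λ j → cyc i j ≟ x)
  ×-dec all? (λ x → all? λ y → G? x y →-dec any? λ i → any? λ j → any? λ j' →
          cycAdj? M j j' ×-dec (((x ≟ cyc i j) ×-dec (y ≟ cyc i j'))
                                ⊎-dec ((y ≟ cyc i j) ×-dec (x ≟ cyc i j'))))
  ×-dec all? (λ i → all? λ j → all? λ j' →
          cycAdj? M j j' →-dec (G? (cyc i j) (cyc i j') ×-dec G? (cyc i j') (cyc i j)))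

byCycles : ∀ {v M k} {G : Graph v} (G? : Decidable G) (cycles : Vec (Vec (Fin v) M) k) →
           {True (isCycleFactorWith? G? (lookup ∘ lookup cycles))} → IsCycleFactor v M G
byCycles {k = k} G? cycles {ok} = k , lookup ∘ lookup cycles , toWitness ok

isOneFactor? : ∀ {v} {G : Graph v} → Decidable G → Dec (IsOneFactor v G)
isOneFactor? G? =
        all? (λ x → any? λ y → G? x y)
  ×-dec all? (λ x → all? λ y → all? λ z → G? x y →-dec G? x z →-dec (y ≟ z))

colourClass? : ∀ {v n} (col : Fin v → Fin v → Fin n) c → Decidable (ColourClass col c)
colourClass? col c x y = ¬? (x ≟ y) ×-dec (col x y ≟ c)

-- Transporting factors

↔-injective : ∀ {A B : Set} (f : A ↔ B) {x y} → Inverse.to f x ≡ Inverse.to f y → x ≡ y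
↔-injective f = Injection.injective (Inverse⇒Injection f)

module _ {v : ℕ} {G H : Graph v} (G⇔H : ∀ x y → G x y ⇔ H x y) where
  private
    toH : ∀ {x y} → G x y → H x y
    toH = Equivalence.to (G⇔H _ _)

    toG : ∀ {x y} → H x y → G x y
    toG = Equivalence.from (G⇔H _ _)

  isCycleFactor-resp-⇔ : ∀ {M} → IsCycleFactor v M H → IsCycleFactor v M G
  isCycleFactor-resp-⇔ (k , cyc , inj , surj , edges , cycles) =
    k , cyc , inj , surj , (λ x y → edges x y ∘ toH) ,
    λ i j j' adj → let (e , e') = cycles i j j' adj in toG e , toG e'

  isOneFactor-resp-⇔ : IsOneFactor v H → IsOneFactor v G
  isOneFactor-resp-⇔ (partner , unique) =
    (λ x → let (y , e) = partner x in y , toG e) ,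
    λ x y z e e' → unique x y z (toH e) (toH e')

module _ {v k t : ℕ} (coords : Fin v ↔ (Fin k × Fin t)) where
  open Inverse coords

  Copies : Graph k → Graph v
  Copies R x y = (proj₂ (to x) ≡ proj₂ (to y)) × R (proj₁ (to x)) (proj₁ (to y))

  private
    from-to : ∀ {x a m} → proj₁ (to x) ≡ a → proj₂ (to x) ≡ m → x ≡ from (a , m)
    from-to {x} refl refl = sym (strictlyInverseʳ x)

  isCycleFactor-copies : ∀ {M R} → IsCycleFactor k M R → IsCycleFactor v M (Copies R)
  isCycleFactor-copies {M} {R} (k₀ , cyc , inj , surj , edges , cycles) =
    k₀ * t , cyc′ , inj′ , surj′ , edges′ , cycles′
    where
    cyc′ : Fin (k₀ * t) → Fin M → Fin v
    cyc′ c j = let (i , m) = remQuot t c in from (cyc i j , m)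

    cyc′-combine : ∀ i m j → cyc′ (combine i m) j ≡ from (cyc i j , m)
    cyc′-combine i m j = cong (λ (i , m) → from (cyc i j , m)) (remQuot-combine i m)

    inj′ : ∀ c j c' j' → cyc′ c j ≡ cyc′ c' j' → (c ≡ c') × (j ≡ j')
    inj′ c j c' j' e =
      let (i , _) = remQuot t c ; (i' , _) = remQuot t c'
          e′ = trans (sym (strictlyInverseˡ _)) (trans (cong to e) (strictlyInverseˡ _))
          (i≡i' , j≡j') = inj i j i' j' (cong proj₁ e′)
      in  trans (sym (combine-remQuot {k₀} t c))
            (trans (cong₂ combine i≡i' (cong proj₂ e′)) (combine-remQuot {k₀} t c')) , j≡j'

    surj′ : ∀ x → ∃ λ c → ∃ λ j → cyc′ c j ≡ x
    surj′ x = let (i , j , e) = surj (proj₁ (to x)) in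
      combine i (proj₂ (to x)) , j , trans (cyc′-combine i _ j) (sym (from-to (sym e) refl))

    edges′ : ∀ x y → Copies R x y → ∃ λ c → ∃ λ j → ∃ λ j' → CycAdj M j j' ×
             (((x ≡ cyc′ c j) × (y ≡ cyc′ c j')) ⊎ ((y ≡ cyc′ c j) × (x ≡ cyc′ c j')))
    edges′ x y (same , r) with edges _ _ r
    ... | i , j , j' , adj , inj₁ (ex , ey) = combine i (proj₂ (to x)) , j , j' , adj , inj₁
          ( trans (from-to ex refl) (sym (cyc′-combine i _ j))
          , trans (from-to ey (sym same)) (sym (cyc′-combine i _ j')) )
    ... | i , j , j' , adj , inj₂ (ey , ex) = combine i (proj₂ (to x)) , j , j' , adj , inj₂
          ( trans (from-to ey (sym same)) (sym (cyc′-combine i _ j))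
          , trans (from-to ex refl) (sym (cyc′-combine i _ j')) )

    cycles′ : ∀ c j j' → CycAdj M j j' →
              Copies R (cyc′ c j) (cyc′ c j') × Copies R (cyc′ c j') (cyc′ c j)
    cycles′ c j j' adj =
      let (r , r') = cycles (proj₁ (remQuot t c)) j j' adj
      in  subst₂ Copies′ (sym (strictlyInverseˡ _)) (sym (strictlyInverseˡ _)) (refl , r) ,
          subst₂ Copies′ (sym (strictlyInverseˡ _)) (sym (strictlyInverseˡ _)) (refl , r')
      where
      Copies′ : Fin k × Fin t → Fin k × Fin t → Set
      Copies′ (a , m) (b , m') = (m ≡ m') × R a b

  isOneFactor-copies : ∀ {R} → IsOneFactor k R → IsOneFactor v (Copies R)
  isOneFactor-copies {R} (partner , unique) = partner′ , unique′
    where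
    partner′ : ∀ x → ∃ λ y → Copies R x y
    partner′ x = let (b , r) = partner (proj₁ (to x)) ; m = proj₂ (to x) in
      from (b , m) ,
      subst (λ z → (m ≡ proj₂ z) × R (proj₁ (to x)) (proj₁ z))
            (sym (strictlyInverseˡ (b , m))) (refl , r)

    unique′ : ∀ x y z → Copies R x y → Copies R x z → y ≡ z
    unique′ x y z (my , ry) (mz , rz) =
      ↔-injective coords (cong₂ _,_ (unique _ _ _ ry rz) (trans (sym my) mz))

-- 1-factorisations of complete graphs

-- factor is a proper edge-colouring of the complete graph on Point, and pairing h lists t disjoint edges
-- of colour h; as these cover all 2t points, they are the whole h-th 1-factor.
record OneFactorisation (t w : ℕ) : Set₁ where
  field
    Point            : Set
    _≟ₚ_             : DecidableEquality Point
    factor           : Point → Point → Fin (ℕ.suc w)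
    factor-sym       : ∀ P Q → factor P Q ≡ factor Q P
    factor-injective : ∀ {P Q Q'} → P ≢ Q → P ≢ Q' → factor P Q ≡ factor P Q' → Q ≡ Q'
    pairing          : Fin (ℕ.suc w) → Point ↔ (Fin 2 × Fin t)
    pairing-factor   : ∀ h k → factor (Inverse.from (pairing h) (zero , k))
                                      (Inverse.from (pairing h) (suc zero , k)) ≡ h

  blockOf : Fin (ℕ.suc w) → Point → Fin t
  blockOf h P = proj₂ (Inverse.to (pairing h) P)

  private
    other : Fin 2 → Fin 2
    other zero = suc zero
    other (suc zero) = zero

    other-≢ : ∀ s → s ≢ other s
    other-≢ zero ()
    other-≢ (suc zero) ()

    ≢⇒other : ∀ {s s'} → s ≢ s' → s' ≡ other s
    ≢⇒other {zero} {zero} s≢s' = ⊥-elim (s≢s' refl)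
    ≢⇒other {zero} {suc zero} _ = refl
    ≢⇒other {suc zero} {zero} _ = refl
    ≢⇒other {suc zero} {suc zero} s≢s' = ⊥-elim (s≢s' refl)

    module _ (h : Fin (ℕ.suc w)) (P : Point) where
      open Inverse (pairing h)

      partner : Point
      partner = from (other (proj₁ (to P)) , proj₂ (to P))

      factor-partner : factor P partner ≡ h
      factor-partner = trans (cong (λ P′ → factor P′ partner) (sym (strictlyInverseʳ P)))
                             (factor-other (proj₁ (to P)) (proj₂ (to P)))
        where
        factor-other : ∀ s k → factor (from (s , k)) (from (other s , k)) ≡ h
        factor-other zero k = pairing-factor h k
        factor-other (suc zero) k = trans (factor-sym _ _) (pairing-factor h k)

      partner-≢ : P ≢ partner
      partner-≢ e = other-≢ (proj₁ (to P)) (cong proj₁ (trans (cong to e) (strictlyInverseˡ _)))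

      blockOf-partner : blockOf h partner ≡ blockOf h P
      blockOf-partner = cong proj₂ (strictlyInverseˡ _)

      same-block⇒partner : ∀ {Q} → P ≢ Q → blockOf h P ≡ blockOf h Q → Q ≡ partner
      same-block⇒partner {Q} P≢Q e =
        trans (sym (strictlyInverseʳ Q)) (cong from (cong₂ _,_ (≢⇒other sides≢) (sym e)))
        where
        sides≢ : proj₁ (to P) ≢ proj₁ (to Q)
        sides≢ s = P≢Q (↔-injective (pairing h) (cong₂ _,_ s e))

  factor≡⇔ : ∀ h {P Q} → P ≢ Q → factor P Q ≡ h ⇔ blockOf h P ≡ blockOf h Q
  factor≡⇔ h {P} {Q} P≢Q = mk⇔
    (λ e → let Q≡ = factor-injective P≢Q (partner-≢ h P) (trans e (sym (factor-partner h P))) in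
           trans (sym (blockOf-partner h P)) (cong (blockOf h) (sym Q≡)))
    (λ e → trans (cong (factor P) (same-block⇒partner h P P≢Q e)) (factor-partner h P))

-- Blowing up a 1-factorisation

sideOf : ∀ m → Fin (2 * m) → Fin 2
sideOf m a = proj₁ (remQuot {2} m a)

-- bcol c c' colours the edge of K_{m,m} joining copy c on side 0 to copy c' on side 1.
orient : ∀ {m r} → (Fin m → Fin m → Fin r) → Fin 2 × Fin m → Fin 2 × Fin m → Fin r
orient bcol (zero , c)     (_ , c') = bcol c c'
orient bcol (suc zero , c) (_ , c') = bcol c' c

orient-sym : ∀ {m r} (bcol : Fin m → Fin m → Fin r) p q → proj₁ p ≢ proj₁ q →
             orient bcol p q ≡ orient bcol q p
orient-sym bcol (zero , _)     (zero , _)     s≢s' = ⊥-elim (s≢s' refl)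
orient-sym bcol (zero , _)     (suc zero , _) _    = refl
orient-sym bcol (suc zero , _) (zero , _)     _    = refl
orient-sym bcol (suc zero , _) (suc zero , _) s≢s' = ⊥-elim (s≢s' refl)

crossColour : ∀ {m r} → (Fin m → Fin m → Fin r) → Fin (2 * m) → Fin (2 * m) → Fin r
crossColour {m} bcol a b = orient bcol (remQuot {2} m a) (remQuot {2} m b)

CrossClass : ∀ {m r} → (Fin m → Fin m → Fin r) → Fin r → Graph (2 * m)
CrossClass {m} bcol s a b = (sideOf m a ≢ sideOf m b) × (crossColour bcol a b ≡ s)

crossClass? : ∀ {m r} (bcol : Fin m → Fin m → Fin r) s → Decidable (CrossClass bcol s)
crossClass? {m} bcol s a b = ¬? (sideOf m a ≟ sideOf m b) ×-dec (crossColour bcol a b ≟ s)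

swap-middle : {A B C : Set} → ((A × B) × C) ↔ ((A × C) × B)
swap-middle = mk↔ₛ′ swap swap (λ _ → refl) (λ _ → refl)
  where
  swap : ∀ {A B C : Set} → (A × B) × C → (A × C) × B
  swap ((a , b) , c) = ((a , c) , b)

module BlowUp {t w m M N α β r : ℕ} (F : OneFactorisation t w) (small : HWP (2 * m) M N α β)
              (bcol : Fin m → Fin m → Fin r)
              (bipartite : ∀ s → IsCycleFactor (2 * m) N (CrossClass bcol s)) where
  open OneFactorisation F

  smallColour : Fin (2 * m) → Fin (2 * m) → Fin (ℕ.suc (α + β))
  smallColour = proj₁ small

  smallColour-sym : ∀ a b → a ≢ b → smallColour a b ≡ smallColour b a
  smallColour-sym = proj₁ (proj₂ small)

  small-oneFactor : IsOneFactor (2 * m) (ColourClass smallColour zero)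
  small-oneFactor = proj₁ (proj₂ (proj₂ small))

  small-M : ∀ i → IsCycleFactor (2 * m) M (ColourClass smallColour (suc (i ↑ˡ β)))
  small-M = proj₁ (proj₂ (proj₂ (proj₂ small)))

  small-N : ∀ j → IsCycleFactor (2 * m) N (ColourClass smallColour (suc (α ↑ʳ j)))
  small-N = proj₂ (proj₂ (proj₂ (proj₂ small)))

  v : ℕ
  v = (2 * m) * t

  place : Fin v ↔ (Point × Fin m)
  place = ↔-trans *↔× (↔-trans (*↔× ×-↔ ↔-refl)
                     (↔-trans swap-middle (↔-sym (pairing zero) ×-↔ ↔-refl)))

  point : Fin v → Point
  point x = proj₁ (Inverse.to place x)

  copy : Fin v → Fin m
  copy x = proj₂ (Inverse.to place x)

  -- with respect to the h-th 1-factor, a vertex is given by the block of its point and by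
  -- (side of the point within that block, copy)
  coords : Fin (ℕ.suc w) → Fin v ↔ (Fin (2 * m) × Fin t)
  coords h = ↔-trans place (↔-trans (pairing h ×-↔ ↔-refl)
                           (↔-trans swap-middle (↔-sym *↔× ×-↔ ↔-refl)))

  side : Fin (ℕ.suc w) → Fin v → Fin 2
  side h x = proj₁ (Inverse.to (pairing h) (point x))

  local : Fin (ℕ.suc w) → Fin v → Fin (2 * m)
  local h x = proj₁ (Inverse.to (coords h) x)

  sideOf-local : ∀ h x → sideOf m (local h x) ≡ side h x
  sideOf-local h x = cong proj₁ (remQuot-combine (side h x) (copy x))

  edgeFactor : Point → Point → Fin (ℕ.suc w)
  edgeFactor P Q with P ≟ₚ Q
  ... | yes _ = zero
  ... | no _ = factor P Q

  edgeFactor-sym : ∀ P Q → edgeFactor P Q ≡ edgeFactor Q P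
  edgeFactor-sym P Q with P ≟ₚ Q | Q ≟ₚ P
  ... | yes _   | yes _   = refl
  ... | yes P≡Q | no Q≢P  = ⊥-elim (Q≢P (sym P≡Q))
  ... | no P≢Q  | yes Q≡P = ⊥-elim (P≢Q (sym Q≡P))
  ... | no _    | no _    = factor-sym P Q

  edgeFactor-block : ∀ h P Q → edgeFactor P Q ≡ h → blockOf h P ≡ blockOf h Q
  edgeFactor-block h P Q e with P ≟ₚ Q
  ... | yes refl = refl
  ... | no P≢Q = Equivalence.to (factor≡⇔ h P≢Q) e

  edgeFactor-suc⇒≢ : ∀ {h} P Q → edgeFactor P Q ≡ suc h → P ≢ Q
  edgeFactor-suc⇒≢ P Q e with P ≟ₚ Q
  edgeFactor-suc⇒≢ P Q () | yes _
  ... | no P≢Q = P≢Q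

  edgeFactor-≢ : ∀ h {P Q} → P ≢ Q → blockOf h P ≡ blockOf h Q → edgeFactor P Q ≡ h
  edgeFactor-≢ h {P} {Q} P≢Q e with P ≟ₚ Q
  ... | yes P≡Q = ⊥-elim (P≢Q P≡Q)
  ... | no P≢Q′ = Equivalence.from (factor≡⇔ h P≢Q′) e

  edgeFactor-zero : ∀ P Q → blockOf zero P ≡ blockOf zero Q → edgeFactor P Q ≡ zero
  edgeFactor-zero P Q e with P ≟ₚ Q
  ... | yes _ = refl
  ... | no P≢Q = Equivalence.from (factor≡⇔ zero P≢Q) e

  locals≢ : ∀ h {x y} → x ≢ y → edgeFactor (point x) (point y) ≡ h → local h x ≢ local h y
  locals≢ h x≢y e l≡l = x≢y (↔-injective (coords h) (cong₂ _,_ l≡l (edgeFactor-block h _ _ e)))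

  sides≢ : ∀ h {x y} → edgeFactor (point x) (point y) ≡ suc h →
           sideOf m (local (suc h) x) ≢ sideOf m (local (suc h) y)
  sides≢ h {x} {y} e s≡s = edgeFactor-suc⇒≢ _ _ e (↔-injective (pairing (suc h))
    (cong₂ _,_ (trans (sym (sideOf-local (suc h) x)) (trans s≡s (sideOf-local (suc h) y)))
               (edgeFactor-block (suc h) _ _ e)))

  -- a colour of the blow-up is a colour of the small design, or a 1-factor h ≠ 0 with a colour of K_{m,m}
  Label : Set
  Label = Fin (ℕ.suc (α + β)) ⊎ (Fin w × Fin r)

  Colour : Set
  Colour = Fin (ℕ.suc (α + (β + w * r)))

  colourOf : Label → Colour
  colourOf (inj₁ zero) = zero
  colourOf (inj₁ (suc c)) = suc (join α (β + w * r) (map₂ (_↑ˡ w * r) (splitAt α c)))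
  colourOf (inj₂ (h , s)) = suc (α ↑ʳ (β ↑ʳ combine h s))

  labelOf : Colour → Label
  labelOf zero = inj₁ zero
  labelOf (suc c) with splitAt α c
  ... | inj₁ i = inj₁ (suc (i ↑ˡ β))
  ... | inj₂ j with splitAt β j
  ...   | inj₁ j₀ = inj₁ (suc (α ↑ʳ j₀))
  ...   | inj₂ q = inj₂ (remQuot r q)

  labelOf-colourOf : ∀ d → labelOf (colourOf d) ≡ d
  labelOf-colourOf (inj₁ zero) = refl
  labelOf-colourOf (inj₁ (suc c)) with splitAt α c in eq
  ... | inj₁ i rewrite splitAt-↑ˡ α i (β + w * r) = cong (inj₁ ∘ suc) (splitAt⁻¹-↑ˡ eq)
  ... | inj₂ j rewrite splitAt-↑ʳ α (β + w * r) (j ↑ˡ w * r) | splitAt-↑ˡ β j (w * r) =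
    cong (inj₁ ∘ suc) (splitAt⁻¹-↑ʳ eq)
  labelOf-colourOf (inj₂ (h , s))
    rewrite splitAt-↑ʳ α (β + w * r) (β ↑ʳ combine h s) | splitAt-↑ʳ β (w * r) (combine h s) =
    cong inj₂ (remQuot-combine h s)

  colourOf-injective : ∀ {d d'} → colourOf d ≡ colourOf d' → d ≡ d'
  colourOf-injective {d} {d'} e =
    trans (sym (labelOf-colourOf d)) (trans (cong labelOf e) (labelOf-colourOf d'))

  colourOf-↑ˡ : ∀ i → colourOf (inj₁ (suc (i ↑ˡ β))) ≡ suc (i ↑ˡ (β + w * r))
  colourOf-↑ˡ i rewrite splitAt-↑ˡ α i β = refl

  colourOf-↑ʳ : ∀ j → colourOf (inj₁ (suc (α ↑ʳ j))) ≡ suc (α ↑ʳ (j ↑ˡ w * r))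
  colourOf-↑ʳ j rewrite splitAt-↑ʳ α β j = refl

  colourOf-remQuot : ∀ q → colourOf (inj₂ (remQuot r q)) ≡ suc (α ↑ʳ (β ↑ʳ q))
  colourOf-remQuot q = cong (λ c → suc (α ↑ʳ (β ↑ʳ c))) (combine-remQuot {w} r q)

  labelAt : Fin (ℕ.suc w) → Fin v → Fin v → Label
  labelAt zero x y = inj₁ (smallColour (local zero x) (local zero y))
  labelAt (suc h) x y = inj₂ (h , crossColour bcol (local (suc h) x) (local (suc h) y))

  colour : Fin v → Fin v → Colour
  colour x y = colourOf (labelAt (edgeFactor (point x) (point y)) x y)

  labelAt-sym : ∀ e {x y} → x ≢ y → edgeFactor (point x) (point y) ≡ e →
                labelAt e x y ≡ labelAt e y x
  labelAt-sym zero x≢y ef = cong inj₁ (smallColour-sym _ _ (locals≢ zero x≢y ef))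
  labelAt-sym (suc h) x≢y ef = cong (λ s → inj₂ (h , s)) (orient-sym bcol _ _ (sides≢ h ef))

  colour-sym : ∀ x y → x ≢ y → colour x y ≡ colour y x
  colour-sym x y x≢y = cong colourOf (trans (labelAt-sym _ x≢y refl)
                         (cong (λ e → labelAt e y x) (edgeFactor-sym (point x) (point y))))

  smallClass⇔ : ∀ g x y → ColourClass colour (colourOf (inj₁ g)) x y ⇔
                          Copies (coords zero) (ColourClass smallColour g) x y
  smallClass⇔ g x y = mk⇔ to from
    where
    labelAt-inj₁ : ∀ e → labelAt e x y ≡ inj₁ g →
                   e ≡ zero × smallColour (local zero x) (local zero y) ≡ g
    labelAt-inj₁ zero refl = refl , refl

    to : ColourClass colour (colourOf (inj₁ g)) x y →
         Copies (coords zero) (ColourClass smallColour g) x y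
    to (x≢y , e) = let (ef , sc) = labelAt-inj₁ _ (colourOf-injective e) in
      edgeFactor-block zero _ _ ef , locals≢ zero x≢y ef , sc

    from : Copies (coords zero) (ColourClass smallColour g) x y →
           ColourClass colour (colourOf (inj₁ g)) x y
    from (bl , a≢b , sc) = (λ { refl → a≢b refl }) ,
      trans (cong (λ e → colourOf (labelAt e x y)) (edgeFactor-zero _ _ bl)) (cong (colourOf ∘ inj₁) sc)

  crossClass⇔ : ∀ h s x y → ColourClass colour (colourOf (inj₂ (h , s))) x y ⇔
                            Copies (coords (suc h)) (CrossClass bcol s) x y
  crossClass⇔ h s x y = mk⇔ to from
    where
    labelAt-inj₂ : ∀ e → labelAt e x y ≡ inj₂ (h , s) →
                   e ≡ suc h × crossColour bcol (local (suc h) x) (local (suc h) y) ≡ s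
    labelAt-inj₂ (suc h) refl = refl , refl

    to : ColourClass colour (colourOf (inj₂ (h , s))) x y →
         Copies (coords (suc h)) (CrossClass bcol s) x y
    to (x≢y , e) = let (ef , cc) = labelAt-inj₂ _ (colourOf-injective e) in
      edgeFactor-block (suc h) _ _ ef , sides≢ h ef , cc

    from : Copies (coords (suc h)) (CrossClass bcol s) x y →
           ColourClass colour (colourOf (inj₂ (h , s))) x y
    from (bl , a≢b , cc) = (λ { refl → a≢b refl }) ,
      trans (cong (λ e → colourOf (labelAt e x y)) (edgeFactor-≢ (suc h) P≢Q bl))
            (cong (λ c → colourOf (inj₂ (h , c))) cc)
      where
      P≢Q : point x ≢ point y
      P≢Q P≡Q = a≢b (trans (sideOf-local (suc h) x)
                  (trans (cong (proj₁ ∘ Inverse.to (pairing (suc h))) P≡Q)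
                         (sym (sideOf-local (suc h) y))))

  blowUp : HWP v M N α (β + w * r)
  blowUp = colour , colour-sym , oneFactor , mFactors , nFactors
    where
    smallFactor : ∀ {K} g → IsCycleFactor (2 * m) K (ColourClass smallColour g) →
                  IsCycleFactor v K (ColourClass colour (colourOf (inj₁ g)))
    smallFactor g = isCycleFactor-resp-⇔ (smallClass⇔ g) ∘ isCycleFactor-copies (coords zero)

    crossFactor : ∀ h s → IsCycleFactor v N (ColourClass colour (colourOf (inj₂ (h , s))))
    crossFactor h s =
      isCycleFactor-resp-⇔ (crossClass⇔ h s) (isCycleFactor-copies (coords (suc h)) (bipartite s))

    recolour : ∀ {K c c'} → c ≡ c' → IsCycleFactor v K (ColourClass colour c) →
               IsCycleFactor v K (ColourClass colour c')
    recolour {K} = subst (λ c → IsCycleFactor v K (ColourClass colour c))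

    oneFactor : IsOneFactor v (ColourClass colour zero)
    oneFactor = isOneFactor-resp-⇔ (smallClass⇔ zero) (isOneFactor-copies (coords zero) small-oneFactor)

    mFactors : ∀ i → IsCycleFactor v M (ColourClass colour (suc (i ↑ˡ (β + w * r))))
    mFactors i = recolour (colourOf-↑ˡ i) (smallFactor _ (small-M i))

    nFactors : ∀ j → IsCycleFactor v N (ColourClass colour (suc (α ↑ʳ j)))
    nFactors j with splitAt β j in eq
    ... | inj₁ j₀ = recolour (trans (colourOf-↑ʳ j₀) (cong (suc ∘ (α ↑ʳ_)) (splitAt⁻¹-↑ˡ eq)))
                             (smallFactor _ (small-N j₀))
    ... | inj₂ q  = recolour (trans (colourOf-remQuot q) (cong (suc ∘ (α ↑ʳ_)) (splitAt⁻¹-↑ʳ eq)))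
                             (crossFactor _ _)

-- Arithmetic modulo n

module Modular (n : ℕ) .{{_ : NonZero n}} where
  open import Data.Nat.Properties using (+-comm; +-assoc; m+[n∸m]≡n; m∸n+n≡m; <⇒≤)
  open import Data.Nat.DivMod
    using (_mod_; %-distribˡ-+; %-distribˡ-*; m%n%n≡m%n; [m+n]%n≡m%n; [m+kn]%n≡m%n; m<n⇒m%n≡m)
  open import Data.Fin.Properties using (toℕ-injective; toℕ-fromℕ<; toℕ<n)
  open ≡-Reasoning

  toℕ-mod : ∀ k → toℕ (k mod n) ≡ k % n
  toℕ-mod k = toℕ-fromℕ< _

  mod-cong : ∀ {k l} → k % n ≡ l % n → k mod n ≡ l mod n
  mod-cong {k} {l} e = toℕ-injective (trans (toℕ-mod k) (trans e (sym (toℕ-mod l))))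

  mod-toℕ : ∀ (a : Fin n) → toℕ a mod n ≡ a
  mod-toℕ a = toℕ-injective (trans (toℕ-mod (toℕ a)) (m<n⇒m%n≡m (toℕ<n a)))

  mod-+kn : ∀ (a : Fin n) k → (toℕ a + k * n) mod n ≡ a
  mod-+kn a k = trans (mod-cong ([m+kn]%n≡m%n (toℕ a) k n)) (mod-toℕ a)

  mod-+n : ∀ (a : Fin n) → (toℕ a + n) mod n ≡ a
  mod-+n a = trans (mod-cong ([m+n]%n≡m%n (toℕ a) n)) (mod-toℕ a)

  mod-absorbˡ-+ : ∀ k l → (toℕ (k mod n) + l) mod n ≡ (k + l) mod n
  mod-absorbˡ-+ k l = mod-cong (begin
    (toℕ (k mod n) + l) % n   ≡⟨ cong (λ x → (x + l) % n) (toℕ-mod k) ⟩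
    (k % n + l) % n           ≡⟨ %-distribˡ-+ (k % n) l n ⟩
    (k % n % n + l % n) % n   ≡⟨ cong (λ x → (x + l % n) % n) (m%n%n≡m%n k n) ⟩
    (k % n + l % n) % n       ≡⟨ %-distribˡ-+ k l n ⟨
    (k + l) % n               ∎)

  mod-absorb-+ : ∀ k l → (toℕ (k mod n) + toℕ (l mod n)) mod n ≡ (k + l) mod n
  mod-absorb-+ k l = begin
    (toℕ (k mod n) + toℕ (l mod n)) mod n   ≡⟨ mod-absorbˡ-+ k _ ⟩
    (k + toℕ (l mod n)) mod n               ≡⟨ cong (_mod n) (+-comm k _) ⟩
    (toℕ (l mod n) + k) mod n               ≡⟨ mod-absorbˡ-+ l k ⟩
    (l + k) mod n                           ≡⟨ cong (_mod n) (+-comm l k) ⟩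
    (k + l) mod n                           ∎

  mod-absorbˡ-* : ∀ k l → (toℕ (k mod n) * l) mod n ≡ (k * l) mod n
  mod-absorbˡ-* k l = mod-cong (begin
    (toℕ (k mod n) * l) % n       ≡⟨ cong (λ x → (x * l) % n) (toℕ-mod k) ⟩
    (k % n * l) % n               ≡⟨ %-distribˡ-* (k % n) l n ⟩
    (k % n % n * (l % n)) % n     ≡⟨ cong (λ x → (x * (l % n)) % n) (m%n%n≡m%n k n) ⟩
    (k % n * (l % n)) % n         ≡⟨ %-distribˡ-* k l n ⟨
    (k * l) % n                   ∎)

  infixl 6 _⊕_ _⊖_

  _⊕_ _⊖_ : Fin n → Fin n → Fin n
  a ⊕ b = (toℕ a + toℕ b) mod n
  a ⊖ b = (toℕ a + (n ∸ toℕ b)) mod n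

  ⊕-comm : ∀ a b → a ⊕ b ≡ b ⊕ a
  ⊕-comm a b = cong (_mod n) (+-comm (toℕ a) (toℕ b))

  ⊕-⊖ : ∀ a h → a ⊕ h ⊖ h ≡ a
  ⊕-⊖ a h = begin
    a ⊕ h ⊖ h                                 ≡⟨ mod-absorbˡ-+ (toℕ a + toℕ h) _ ⟩
    (toℕ a + toℕ h + (n ∸ toℕ h)) mod n       ≡⟨ cong (_mod n) (+-assoc (toℕ a) _ _) ⟩
    (toℕ a + (toℕ h + (n ∸ toℕ h))) mod n     ≡⟨ cong (λ x → (toℕ a + x) mod n) (m+[n∸m]≡n h≤n) ⟩
    (toℕ a + n) mod n                         ≡⟨ mod-+n a ⟩
    a                                         ∎
    where h≤n = <⇒≤ (toℕ<n h)

  ⊖-⊕ : ∀ a h → a ⊖ h ⊕ h ≡ a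
  ⊖-⊕ a h = begin
    a ⊖ h ⊕ h                                 ≡⟨ mod-absorbˡ-+ (toℕ a + (n ∸ toℕ h)) _ ⟩
    (toℕ a + (n ∸ toℕ h) + toℕ h) mod n       ≡⟨ cong (_mod n) (+-assoc (toℕ a) _ _) ⟩
    (toℕ a + ((n ∸ toℕ h) + toℕ h)) mod n     ≡⟨ cong (λ x → (toℕ a + x) mod n) (m∸n+n≡m h≤n) ⟩
    (toℕ a + n) mod n                         ≡⟨ mod-+n a ⟩
    a                                         ∎
    where h≤n = <⇒≤ (toℕ<n h)

  ⊕-cancelˡ : ∀ a {b b'} → a ⊕ b ≡ a ⊕ b' → b ≡ b'
  ⊕-cancelˡ a {b} {b'} e = begin
    b           ≡⟨ ⊕-⊖ b a ⟨
    b ⊕ a ⊖ a   ≡⟨ cong (_⊖ a) (trans (⊕-comm b a) (trans e (⊕-comm a b'))) ⟩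
    b' ⊕ a ⊖ a  ≡⟨ ⊕-⊖ b' a ⟩
    b'          ∎

-- The round-robin 1-factorisation of K_{2t}

module RoundRobin (u : ℕ) where
  open import Data.Nat.Properties using (m+[n∸m]≡n)
  open import Data.Nat.DivMod using (_mod_)
  open import Data.Fin using (opposite)
  open import Data.Fin.Properties using (toℕ<n; toℕ-↑ˡ; toℕ-↑ʳ; opposite-prop; opposite-involutive)
  open import Data.Maybe using (Maybe; just; nothing; map)
  import Data.Maybe.Properties as Maybe
  open ≡-Reasoning

  t n : ℕ
  t = ℕ.suc u
  n = ℕ.suc (u + u)

  open Modular n

  Point : Set
  Point = Maybe (Fin n)

  -- halving, as 2 * t ≡ 1 modulo n
  half : Fin n → Fin n
  half a = (toℕ a * t) mod n

  half-⊕-half : ∀ c → half c ⊕ half c ≡ c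
  half-⊕-half c = begin
    half c ⊕ half c                 ≡⟨ mod-absorb-+ (toℕ c * t) (toℕ c * t) ⟩
    (toℕ c * t + toℕ c * t) mod n   ≡⟨ cong (_mod n) (twice (toℕ c) u) ⟩
    (toℕ c + toℕ c * n) mod n       ≡⟨ mod-+kn c (toℕ c) ⟩
    c                               ∎
    where
    twice : ∀ c u → c * ℕ.suc u + c * ℕ.suc u ≡ c + c * ℕ.suc (u + u)
    twice = solve-∀

  half≡⇒ : ∀ {c a} → half c ≡ a → c ≡ a ⊕ a
  half≡⇒ {c} e = trans (sym (half-⊕-half c)) (cong (λ x → x ⊕ x) e)

  half-injective : ∀ {c c'} → half c ≡ half c' → c ≡ c'
  half-injective {c' = c'} e = trans (half≡⇒ e) (half-⊕-half c')

  half-translate : ∀ a b h → toℕ a + toℕ b ≡ n → half (a ⊕ h ⊕ (b ⊕ h)) ≡ h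
  half-translate a b h e = begin
    half (a ⊕ h ⊕ (b ⊕ h))
      ≡⟨ cong (λ x → (toℕ x * t) mod n) (mod-absorb-+ A B) ⟩
    (toℕ ((A + B) mod n) * t) mod n
      ≡⟨ mod-absorbˡ-* (A + B) t ⟩
    ((A + B) * t) mod n
      ≡⟨ cong (λ x → (x * t) mod n) (regroup (toℕ a) (toℕ b) (toℕ h)) ⟩
    ((toℕ a + toℕ b + (toℕ h + toℕ h)) * t) mod n
      ≡⟨ cong (λ x → ((x + (toℕ h + toℕ h)) * t) mod n) e ⟩
    ((n + (toℕ h + toℕ h)) * t) mod n
      ≡⟨ cong (_mod n) (expand (toℕ h) u) ⟩
    (toℕ h + (t + toℕ h) * n) mod n
      ≡⟨ mod-+kn h (t + toℕ h) ⟩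
    h ∎
    where
    A B : ℕ
    A = toℕ a + toℕ h
    B = toℕ b + toℕ h
    regroup : ∀ a b h → a + h + (b + h) ≡ a + b + (h + h)
    regroup = solve-∀
    expand : ∀ h u → (ℕ.suc (u + u) + (h + h)) * ℕ.suc u ≡ h + (ℕ.suc u + h) * ℕ.suc (u + u)
    expand = solve-∀

  factor : Point → Point → Fin n
  factor nothing nothing = zero
  factor nothing (just b) = b
  factor (just a) nothing = a
  factor (just a) (just b) = half (a ⊕ b)

  factor-sym : ∀ P Q → factor P Q ≡ factor Q P
  factor-sym nothing nothing = refl
  factor-sym nothing (just b) = refl
  factor-sym (just a) nothing = refl
  factor-sym (just a) (just b) = cong half (⊕-comm a b)

  factor-injective : ∀ {P Q Q'} → P ≢ Q → P ≢ Q' → factor P Q ≡ factor P Q' → Q ≡ Q'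
  factor-injective {nothing} {nothing} P≢Q _ _ = ⊥-elim (P≢Q refl)
  factor-injective {nothing} {just _} {nothing} _ P≢Q' _ = ⊥-elim (P≢Q' refl)
  factor-injective {nothing} {just b} {just b'} _ _ e = cong just e
  factor-injective {just a} {nothing} {nothing} _ _ _ = refl
  factor-injective {just a} {nothing} {just b'} _ P≢Q' e =
    ⊥-elim (P≢Q' (cong just (sym (⊕-cancelˡ a (half≡⇒ (sym e))))))
  factor-injective {just a} {just b} {nothing} P≢Q _ e =
    ⊥-elim (P≢Q (cong just (sym (⊕-cancelˡ a (half≡⇒ e)))))
  factor-injective {just a} {just b} {just b'} _ _ e = cong just (⊕-cancelˡ a (half-injective e))

  translate : Fin n → Point ↔ Point
  translate h = mk↔ₛ′ (map (_⊕ h)) (map (_⊖ h)) ⊕-after-⊖ ⊖-after-⊕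
    where
    ⊕-after-⊖ : ∀ P → map (_⊕ h) (map (_⊖ h) P) ≡ P
    ⊕-after-⊖ nothing = refl
    ⊕-after-⊖ (just a) = cong just (⊖-⊕ a h)

    ⊖-after-⊕ : ∀ P → map (_⊖ h) (map (_⊕ h) P) ≡ P
    ⊖-after-⊕ nothing = refl
    ⊖-after-⊕ (just a) = cong just (⊕-⊖ a h)

  -- Fin n = Fin (t + u); the blocks of the 0-th factor are {0, ∞} and {k, n - k} for 0 < k < t.
  fold : Point → Fin 2 × Fin t
  fold nothing = suc zero , zero
  fold (just a) with splitAt t a
  ... | inj₁ k = zero , k
  ... | inj₂ j = suc zero , suc (opposite j)

  unfold : Fin 2 × Fin t → Point
  unfold (zero , k) = just (k ↑ˡ u)
  unfold (suc zero , zero) = nothing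
  unfold (suc zero , suc j) = just (t ↑ʳ opposite j)

  fold↔ : Point ↔ (Fin 2 × Fin t)
  fold↔ = mk↔ₛ′ fold unfold fold-unfold unfold-fold
    where
    fold-unfold : ∀ p → fold (unfold p) ≡ p
    fold-unfold (zero , k) rewrite splitAt-↑ˡ t k u = refl
    fold-unfold (suc zero , zero) = refl
    fold-unfold (suc zero , suc j) rewrite splitAt-↑ʳ t u (opposite j) | opposite-involutive j = refl

    unfold-fold : ∀ P → unfold (fold P) ≡ P
    unfold-fold nothing = refl
    unfold-fold (just a) with splitAt t a in eq
    ... | inj₁ k = cong just (splitAt⁻¹-↑ˡ eq)
    ... | inj₂ j rewrite opposite-involutive j = cong just (splitAt⁻¹-↑ʳ eq)

  unfold-sum : ∀ (j : Fin u) → toℕ (suc j ↑ˡ u) + toℕ (t ↑ʳ opposite j) ≡ n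
  unfold-sum j = begin
    toℕ (suc j ↑ˡ u) + toℕ (t ↑ʳ opposite j)
      ≡⟨ cong₂ _+_ (toℕ-↑ˡ (suc j) u)
                   (trans (toℕ-↑ʳ t (opposite j)) (cong (t +_) (opposite-prop j))) ⟩
    ℕ.suc (toℕ j) + (t + (u ∸ ℕ.suc (toℕ j)))
      ≡⟨ exchange (ℕ.suc (toℕ j)) t _ ⟩
    t + (ℕ.suc (toℕ j) + (u ∸ ℕ.suc (toℕ j)))
      ≡⟨ cong (t +_) (m+[n∸m]≡n (toℕ<n j)) ⟩
    t + u ∎
    where
    exchange : ∀ a b c → a + (b + c) ≡ b + (a + c)
    exchange = solve-∀

  pairing : Fin n → Point ↔ (Fin 2 × Fin t)
  pairing h = ↔-trans (↔-sym (translate h)) fold↔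

  pairing-factor : ∀ h k → factor (Inverse.from (pairing h) (zero , k))
                                  (Inverse.from (pairing h) (suc zero , k)) ≡ h
  pairing-factor h zero = mod-toℕ h
  pairing-factor h (suc j) = half-translate (suc j ↑ˡ u) (t ↑ʳ opposite j) h (unfold-sum j)

  roundRobin : OneFactorisation t (u + u)
  roundRobin = record
    { Point = Point ; _≟ₚ_ = Maybe.≡-dec _≟_
    ; factor = factor ; factor-sym = factor-sym ; factor-injective = factor-injective
    ; pairing = pairing ; pairing-factor = pairing-factor
    }

-- Two small designs

colour₁₂ : Fin 12 → Fin 12 → Fin 6
colour₁₂ = lookup ∘ lookup table
  where
  table : Vec (Vec (Fin 6) 12) 12
  table =
    (# 0 ∷ # 2 ∷ # 2 ∷ # 3 ∷ # 4 ∷ # 1 ∷ # 0 ∷ # 5 ∷ # 5 ∷ # 3 ∷ # 1 ∷ # 4 ∷ []) ∷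
    (# 2 ∷ # 0 ∷ # 3 ∷ # 2 ∷ # 5 ∷ # 3 ∷ # 1 ∷ # 0 ∷ # 4 ∷ # 4 ∷ # 5 ∷ # 1 ∷ []) ∷
    (# 2 ∷ # 3 ∷ # 0 ∷ # 2 ∷ # 4 ∷ # 5 ∷ # 1 ∷ # 1 ∷ # 0 ∷ # 5 ∷ # 3 ∷ # 4 ∷ []) ∷
    (# 3 ∷ # 2 ∷ # 2 ∷ # 0 ∷ # 5 ∷ # 1 ∷ # 4 ∷ # 4 ∷ # 1 ∷ # 0 ∷ # 5 ∷ # 3 ∷ []) ∷
    (# 4 ∷ # 5 ∷ # 4 ∷ # 5 ∷ # 0 ∷ # 2 ∷ # 3 ∷ # 1 ∷ # 3 ∷ # 2 ∷ # 0 ∷ # 1 ∷ []) ∷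
    (# 1 ∷ # 3 ∷ # 5 ∷ # 1 ∷ # 2 ∷ # 0 ∷ # 5 ∷ # 2 ∷ # 4 ∷ # 4 ∷ # 3 ∷ # 0 ∷ []) ∷
    (# 0 ∷ # 1 ∷ # 1 ∷ # 4 ∷ # 3 ∷ # 5 ∷ # 0 ∷ # 3 ∷ # 2 ∷ # 5 ∷ # 4 ∷ # 2 ∷ []) ∷
    (# 5 ∷ # 0 ∷ # 1 ∷ # 4 ∷ # 1 ∷ # 2 ∷ # 3 ∷ # 0 ∷ # 3 ∷ # 2 ∷ # 4 ∷ # 5 ∷ []) ∷
    (# 5 ∷ # 4 ∷ # 0 ∷ # 1 ∷ # 3 ∷ # 4 ∷ # 2 ∷ # 3 ∷ # 0 ∷ # 1 ∷ # 2 ∷ # 5 ∷ []) ∷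
    (# 3 ∷ # 4 ∷ # 5 ∷ # 0 ∷ # 2 ∷ # 4 ∷ # 5 ∷ # 2 ∷ # 1 ∷ # 0 ∷ # 1 ∷ # 3 ∷ []) ∷
    (# 1 ∷ # 5 ∷ # 3 ∷ # 5 ∷ # 0 ∷ # 3 ∷ # 4 ∷ # 4 ∷ # 2 ∷ # 1 ∷ # 0 ∷ # 2 ∷ []) ∷
    (# 4 ∷ # 1 ∷ # 4 ∷ # 3 ∷ # 1 ∷ # 0 ∷ # 2 ∷ # 5 ∷ # 5 ∷ # 3 ∷ # 2 ∷ # 0 ∷ []) ∷
    []

hwp-12 : HWP 12 6 4 1 4
hwp-12 = colour₁₂ , symmetric , oneFactor , hexagons , squares
  where
  class? : ∀ c → Decidable (ColourClass colour₁₂ c)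
  class? = colourClass? colour₁₂

  symmetric : ∀ x y → x ≢ y → colour₁₂ x y ≡ colour₁₂ y x
  symmetric = toWitness
    {a? = all? λ x → all? λ y → ¬? (x ≟ y) →-dec (colour₁₂ x y ≟ colour₁₂ y x)} _

  oneFactor : IsOneFactor 12 (ColourClass colour₁₂ zero)
  oneFactor = toWitness {a? = isOneFactor? (class? zero)} _

  hexagons : ∀ i → IsCycleFactor 12 6 (ColourClass colour₁₂ (suc (i ↑ˡ 4)))
  hexagons zero = byCycles (class? (# 1))
    ( (# 4 ∷ # 7 ∷ # 2 ∷ # 6 ∷ # 1 ∷ # 11 ∷ []) ∷
      (# 3 ∷ # 8 ∷ # 9 ∷ # 10 ∷ # 0 ∷ # 5 ∷ []) ∷ [] )

  squares : ∀ j → IsCycleFactor 12 4 (ColourClass colour₁₂ (suc (1 ↑ʳ j)))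
  squares zero = byCycles (class? (# 2))
    ( (# 0 ∷ # 1 ∷ # 3 ∷ # 2 ∷ []) ∷
      (# 4 ∷ # 5 ∷ # 7 ∷ # 9 ∷ []) ∷
      (# 6 ∷ # 8 ∷ # 10 ∷ # 11 ∷ []) ∷ [] )
  squares (suc zero) = byCycles (class? (# 3))
    ( (# 0 ∷ # 3 ∷ # 11 ∷ # 9 ∷ []) ∷
      (# 1 ∷ # 2 ∷ # 10 ∷ # 5 ∷ []) ∷
      (# 4 ∷ # 6 ∷ # 7 ∷ # 8 ∷ []) ∷ [] )
  squares (suc (suc zero)) = byCycles (class? (# 4))
    ( (# 0 ∷ # 4 ∷ # 2 ∷ # 11 ∷ []) ∷
      (# 1 ∷ # 8 ∷ # 5 ∷ # 9 ∷ []) ∷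
      (# 3 ∷ # 6 ∷ # 10 ∷ # 7 ∷ []) ∷ [] )
  squares (suc (suc (suc zero))) = byCycles (class? (# 5))
    ( (# 0 ∷ # 7 ∷ # 11 ∷ # 8 ∷ []) ∷
      (# 1 ∷ # 4 ∷ # 3 ∷ # 10 ∷ []) ∷
      (# 2 ∷ # 5 ∷ # 6 ∷ # 9 ∷ []) ∷ [] )

-- The Latin square of ℤ₃ with every entry doubled: each colour class is three disjoint K₂,₂ = C₄.
colour₆,₆ : Fin 6 → Fin 6 → Fin 3
colour₆,₆ = lookup ∘ lookup table
  where
  table : Vec (Vec (Fin 3) 6) 6
  table =
    (# 0 ∷ # 0 ∷ # 1 ∷ # 1 ∷ # 2 ∷ # 2 ∷ []) ∷
    (# 0 ∷ # 0 ∷ # 1 ∷ # 1 ∷ # 2 ∷ # 2 ∷ []) ∷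
    (# 2 ∷ # 2 ∷ # 0 ∷ # 0 ∷ # 1 ∷ # 1 ∷ []) ∷
    (# 2 ∷ # 2 ∷ # 0 ∷ # 0 ∷ # 1 ∷ # 1 ∷ []) ∷
    (# 1 ∷ # 1 ∷ # 2 ∷ # 2 ∷ # 0 ∷ # 0 ∷ []) ∷
    (# 1 ∷ # 1 ∷ # 2 ∷ # 2 ∷ # 0 ∷ # 0 ∷ []) ∷
    []

squares₆,₆ : ∀ s → IsCycleFactor 12 4 (CrossClass colour₆,₆ s)
squares₆,₆ zero = byCycles (crossClass? colour₆,₆ zero)
  ( (# 0 ∷ # 6 ∷ # 1 ∷ # 7 ∷ []) ∷
    (# 2 ∷ # 8 ∷ # 3 ∷ # 9 ∷ []) ∷
    (# 4 ∷ # 10 ∷ # 5 ∷ # 11 ∷ []) ∷ [] )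
squares₆,₆ (suc zero) = byCycles (crossClass? colour₆,₆ (# 1))
  ( (# 0 ∷ # 8 ∷ # 1 ∷ # 9 ∷ []) ∷
    (# 2 ∷ # 10 ∷ # 3 ∷ # 11 ∷ []) ∷
    (# 4 ∷ # 6 ∷ # 5 ∷ # 7 ∷ []) ∷ [] )
squares₆,₆ (suc (suc zero)) = byCycles (crossClass? colour₆,₆ (# 2))
  ( (# 0 ∷ # 10 ∷ # 1 ∷ # 11 ∷ []) ∷
    (# 2 ∷ # 6 ∷ # 3 ∷ # 7 ∷ []) ∷
    (# 4 ∷ # 8 ∷ # 5 ∷ # 9 ∷ []) ∷ [] )

theorem6 : (t : ℕ) → 1 ≤ t → HWP (12 * t) 6 4 1 (6 * t ∸ 2)
theorem6 (ℕ.suc u) _ = subst (HWP (12 * ℕ.suc u) 6 4 1) (cong (_∸ 2) (colourCount u))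
  (BlowUp.blowUp (RoundRobin.roundRobin u) hwp-12 colour₆,₆ squares₆,₆)
  where
  colourCount : ∀ u → 2 + (4 + (u + u) * 3) ≡ 6 * ℕ.suc u
  colourCount = solve-∀
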